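{- For all $k,r\in\mathbb N$ with $r\le k$ and every finite set $V$: if $\gamma\in\mathcal P(V^k)$ is graph-like and $\mathrm C_{k,r}$-stable, then $\mathrm{pr}_{k-r+1}\gamma$ is $\mathrm C_{k-r+1}$-stable.
   Context: $[k]=\{1,\dots,k\}$; $[k]^{(r)}$ is the set of $r$-tuples of pairwise distinct elements of $[k]$. A labelled partition of $A$ is a function $\gamma:A\to L$; $\mathcal P(A)$ is the class of these; $\gamma\approx\rho$ means $\gamma(a)=\gamma(b)\iff\rho(a)=\rho(b)$. $\vec v\langle\vec i,\vec u\rangle$ is $\vec v\in V^k$ with $u_s$ put in position $i_s$. For $\vec j\in[k]^t$, $\mathrm{pr}_{\vec j}\vec v=(v_{j_1},\dots,v_{j_t})$; $\mathrm{pr}_t\gamma(w_1,\dots,w_t)=\gamma(w_1,\dots,w_t,w_t,\dots,w_t)$. $\gamma\in\mathcal P(V^k)$ is graph-like if (i) $\gamma(\vec u)=\gamma(\vec v)\Rightarrow\gamma(\vec u^\tau)=\gamma(\vec v^\tau)$ for all $\tau\in\mathrm{Sym}(k)$, $(\vec v^\tau)_i=v_{\tau^{ -1}(i)}$; (ii) for all $t\le k$, $\vec j\in[k]^t$: $\gamma(\vec u)=\gamma(\vec v)\Rightarrow\mathrm{pr}_t\gamma(\mathrm{pr}_{\vec j}\vec u)=\mathrm{pr}_t\gamma(\mathrm{pr}_{\vec j}\vec v)$; (iii) $\gamma(\vec u)=\gamma(\vec v)$ implies ($u_i=u_j\Rightarrow v_i=v_j$). For $n\le s$, $\mathrm C_{n,s}\circ\gamma=\gamma$;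 for $s<n$ and $\gamma\in\mathcal P(V^n)$, $\mathrm C_{n,s}\circ\gamma(\vec v)=\big(\gamma(\vec v),(\{\{\gamma(\vec v\langle\vec i,\vec x\rangle):\vec x\in V^s\}\})_{\vec i\in[n]^{(s)}}\big)$ (multisets); $\mathrm C_n=\mathrm C_{n,1}$. $\gamma$ is $R$-stable if $R\circ\gamma\approx\gamma$. -}

module Defs where

open import Data.Nat using (ℕ; zero; suc; _<_; _≤_; _∸_; _+_)
open import Data.Fin using (Fin; zero; suc; _≟_)
open import Data.Fin.Permutation using (Permutation′; _⟨$⟩ˡ_)
open import Data.Vec using (Vec; []; _∷_; lookup; tabulate; map)
open import Data.Vec.Relation.Unary.Unique.Propositional using (Unique)
open import Data.List using (List; concatMap; allFin) renaming (map to mapL; [_] to [_]L)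
open import Data.List.Relation.Binary.Permutation.Propositional using (_↭_)
open import Data.Product using (_×_)
open import Relation.Binary.PropositionalEquality using (_≡_)
open import Relation.Nullary using (yes; no)

-- Throughout, the finite set V is  Fin m,  and V^k is  Vec (Fin m) k.
-- A labelled partition of V^k is a function  Vec (Fin m) k → L.

Distinct : ∀ {k s} → Vec (Fin k) s → Set
Distinct i = Unique i

put : ∀ {A : Set} {k s} → Vec A k → Vec (Fin k) s → Vec A s → Vec A k
put v [] [] = v
put v (i ∷ is) (x ∷ xs) = tabulate λ p → go p (i ≟ p)
  where
  go : ∀ {P : Set} → Fin _ → Relation.Nullary.Dec P → _
  go p (yes _) = x
  go p (no _)  = lookup (put v is xs) p

allVecs : ∀ m s → List (Vec (Fin m) s)
allVecs m zero    = [ [] ]L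
allVecs m (suc s) = concatMap (λ x → mapL (x ∷_) (allVecs m s)) (allFin m)

-- The multiset {{ γ(v⟨i,x⟩) : x ∈ V^s }}, as a list up to permutation (_↭_).
multiset : ∀ {L : Set} {m k} s → (Vec (Fin m) k → L) → Vec (Fin m) k → Vec (Fin k) s → List L
multiset {m = m} s γ v i = mapL (λ x → γ (put v i x)) (allVecs m s)

-- Equality of the colours  C_{n,s} ∘ γ (u)  and  C_{n,s} ∘ γ (v):
-- equal first components, and (only when s < n) equal multisets for every i ∈ [n]^(s).
-- (For n ≤ s, C_{n,s} ∘ γ = γ.)
CEq : ∀ {L : Set} {m} n s → (Vec (Fin m) n → L) → Vec (Fin m) n → Vec (Fin m) n → Set
CEq n s γ u v =
  γ u ≡ γ v ×
  (s < n → (i : Vec (Fin n) s) → Distinct i → multiset s γ u i ↭ multiset s γ v i)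

CStable : ∀ {L : Set} {m} n s → (Vec (Fin m) n → L) → Set
CStable n s γ = ∀ u v → (CEq n s γ u v → γ u ≡ γ v) × (γ u ≡ γ v → CEq n s γ u v)

clamp : ∀ {k} → Fin k → (t : ℕ) → Fin (suc t)
clamp zero    t       = zero
clamp (suc p) zero    = zero
clamp (suc p) (suc t) = suc (clamp p t)

-- pr_{t+1} γ (w_1,…,w_{t+1}) = γ(w_1,…,w_{t+1},w_{t+1},…,w_{t+1})  (for t+1 ≤ k).
pr : ∀ {L : Set} {m k} t → (Vec (Fin m) k → L) → Vec (Fin m) (suc t) → L
pr t γ w = γ (tabulate λ p → lookup w (clamp p t))

prj : ∀ {A : Set} {k t} → Vec (Fin k) t → Vec A k → Vec A t
prj j v = map (lookup v) j

-- v^τ with (v^τ)_i = v_{τ⁻¹(i)}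
permute : ∀ {A : Set} {k} → Permutation′ k → Vec A k → Vec A k
permute τ v = tabulate λ i → lookup v (τ ⟨$⟩ˡ i)

record GraphLike {L : Set} {m} k (γ : Vec (Fin m) k → L) : Set where
  field
    sym-inv  : ∀ (τ : Permutation′ k) u v → γ u ≡ γ v → γ (permute τ u) ≡ γ (permute τ v)
    proj-inv : ∀ t → suc t ≤ k → (j : Vec (Fin k) (suc t)) → ∀ u v → γ u ≡ γ v →
               pr t γ (prj j u) ≡ pr t γ (prj j v)
    eq-inv   : ∀ u v → γ u ≡ γ v → ∀ i j → lookup u i ≡ lookup u j → lookup v i ≡ lookup v j

module Submission where

-- Write k = (t+1) + s with r = s+1, and let  extend w ∈ V^k  be w ∈ V^(t+1) followed by s
-- copies of its last entry, so that pr_{t+1} γ (w) = γ (extend w).  Fix a position p of w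
-- and the r distinct positions I = (p, t+1, …, t+s).  If γ (extend u) = γ (extend v), then
-- C_{k,r}-stability matches the colours γ (extend u⟨I,c⟩) and γ (extend v⟨I,c⟩), c ∈ V^r,
-- bijectively.  By (iii) the matching sends constant c to constant c, and by (ii), projecting
-- onto the first t+1 coordinates, it preserves colours of the projections; for c = (x,…,x)
-- that projection is u⟨p,x⟩.  So the matching restricted to constant tuples is exactly
-- the multiset equality required for C_{t+1}-stability of pr_{t+1} γ.

open import Defs
open import Data.Nat using (ℕ; zero; suc; _+_; _≤_; _∸_; s≤s)
open import Data.Nat.Properties using (m≤m+n; +-monoˡ-≤; m∸n+n≡m; +-suc)
open import Data.Fin using (Fin; zero; suc; _≟_; _↑ˡ_; _↑ʳ_)
open import Data.Fin.Properties using (↑ˡ-injective; ↑ʳ-injective; suc-injective)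
open import Data.Vec using (Vec; []; _∷_; head; lookup; tabulate; replicate)
open import Data.Vec.Properties using (∷-injective; lookup∘tabulate; tabulate∘lookup; tabulate-cong; lookup-map)
open import Data.Vec.Relation.Unary.All as All using (All; []; _∷_; all?)
open import Data.Vec.Relation.Unary.All.Properties using (lookup⁺; lookup⁻)
open import Data.Vec.Relation.Unary.AllPairs using ([]; _∷_)
open import Data.Vec.Relation.Unary.Unique.Propositional.Properties using (tabulate⁺)
open import Data.List using (List; []; _∷_; _++_; concatMap; allFin; filter; cartesianProductWith)
  renaming (map to mapL)
open import Data.List.Properties using (map-∘; map-cong) renaming (∷-injective to ∷-injectiveL)
open import Data.List.Membership.Propositional using (_∈_)
open import Data.List.Membership.Propositional.Properties
  using (∈-allFin; ∈-map⁺; ∈-map⁻; ∈-filter⁺; ∈-filter⁻; ∈-cartesianProductWith⁺)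
open import Data.List.Membership.Propositional.Properties.WithK using (unique∧set⇒bag)
open import Data.List.Relation.Unary.Any using (here)
import Data.List.Relation.Unary.All as ListAll
import Data.List.Relation.Unary.AllPairs as ListAllPairs
open import Data.List.Relation.Unary.Unique.Propositional using () renaming (Unique to UniqueL)
import Data.List.Relation.Unary.Unique.Propositional.Properties as UniqueL
open import Data.List.Relation.Binary.BagAndSetEquality using (∼bag⇒↭)
open import Data.List.Relation.Binary.Permutation.Propositional
  using (_↭_; ↭-sym; ↭-trans; ↭-reflexive; module PermutationReasoning)
open import Data.List.Relation.Binary.Permutation.Propositional.Properties using (↭-map-inv; map⁺; filter-↭)
open import Data.Product using (_,_; proj₁; proj₂)
open import Data.Empty using (⊥-elim)
open import Function using (_∘_)
open import Function.Bundles using (_⇔_; mk⇔; Equivalence)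
open import Relation.Binary.PropositionalEquality
open import Relation.Nullary using (Dec; yes; no; ¬_)
open import Relation.Unary using (Decidable)

lookup-ext : ∀ {A : Set} {n} {xs ys : Vec A n} → (∀ i → lookup xs i ≡ lookup ys i) → xs ≡ ys
lookup-ext {xs = xs} {ys} eq = trans (sym (tabulate∘lookup xs)) (trans (tabulate-cong eq) (tabulate∘lookup ys))

All≡⇒replicate : ∀ {A : Set} {n} {x : A} {xs : Vec A n} → All (_≡ x) xs → xs ≡ replicate n x
All≡⇒replicate []           = refl
All≡⇒replicate (refl ∷ xs≡) = cong (_ ∷_) (All≡⇒replicate xs≡)

All≡-replicate : ∀ {A : Set} n (x : A) → All (_≡ x) (replicate n x)
All≡-replicate zero    x = []
All≡-replicate (suc n) x = refl ∷ All≡-replicate n x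

-- put is a tabulate over an anonymous helper, so its entries are reached through this equation.
lookup-tabulated : ∀ {A : Set} {n} {v : Vec A n} {f : Fin n → A} → v ≡ tabulate f → ∀ q → lookup v q ≡ f q
lookup-tabulated refl = lookup∘tabulate _

module _ {A : Set} {k s} (W : Vec A k) (i : Fin k) (is : Vec (Fin k) s) (x : A) (xs : Vec A s) where

  lookup-put-here : lookup (put W (i ∷ is) (x ∷ xs)) i ≡ x
  lookup-put-here rewrite lookup-tabulated {v = put W (i ∷ is) (x ∷ xs)} refl i with i ≟ i
  ... | yes _   = refl
  ... | no i≢i = ⊥-elim (i≢i refl)

  lookup-put-there : ∀ {q} → ¬ i ≡ q → lookup (put W (i ∷ is) (x ∷ xs)) q ≡ lookup (put W is xs) q
  lookup-put-there {q} i≢q rewrite lookup-tabulated {v = put W (i ∷ is) (x ∷ xs)} refl q with i ≟ q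
  ... | yes i≡q = ⊥-elim (i≢q i≡q)
  ... | no _    = refl

lookup-put-index : ∀ {A : Set} {k s} (W : Vec A k) {I : Vec (Fin k) s} (b : Vec A s) → Distinct I →
                   ∀ j → lookup (put W I b) (lookup I j) ≡ lookup b j
lookup-put-index W {i ∷ is} (x ∷ xs) (i∉is ∷ _) zero = lookup-put-here W i is x xs
lookup-put-index W {i ∷ is} (x ∷ xs) (i∉is ∷ is!) (suc j) =
  trans (lookup-put-there W i is x xs (lookup⁺ i∉is j)) (lookup-put-index W xs is! j)

lookup-put-outside : ∀ {A : Set} {k s} (W : Vec A k) {I : Vec (Fin k) s} (b : Vec A s) {q} →
                     All (λ i → ¬ i ≡ q) I → lookup (put W I b) q ≡ lookup W q
lookup-put-outside W []       []             = refl
lookup-put-outside W (x ∷ xs) (i≢q ∷ is≢q) =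
  trans (lookup-put-there W _ _ x xs i≢q) (lookup-put-outside W xs is≢q)

allVecs-suc : ∀ m s → allVecs m (suc s) ≡ cartesianProductWith _∷_ (allFin m) (allVecs m s)
allVecs-suc m s = go (allFin m)
  where
  go : ∀ xs → concatMap (λ x → mapL (x ∷_) (allVecs m s)) xs ≡ cartesianProductWith _∷_ xs (allVecs m s)
  go []       = refl
  go (x ∷ xs) = cong (mapL (x ∷_) (allVecs m s) ++_) (go xs)

allVecs-one : ∀ m → allVecs m 1 ≡ mapL (_∷ []) (allFin m)
allVecs-one m = go (allFin m)
  where
  go : (xs : List (Fin m)) → concatMap (λ x → mapL (x ∷_) (allVecs m 0)) xs ≡ mapL (_∷ []) xs
  go []       = refl
  go (x ∷ xs) = cong ((x ∷ []) ∷_) (go xs)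

∈-allVecs : ∀ {m s} (v : Vec (Fin m) s) → v ∈ allVecs m s
∈-allVecs []               = here refl
∈-allVecs {m} {suc s} (x ∷ v) =
  subst (x ∷ v ∈_) (sym (allVecs-suc m s)) (∈-cartesianProductWith⁺ _∷_ (∈-allFin x) (∈-allVecs v))

allVecs-unique : ∀ m s → UniqueL (allVecs m s)
allVecs-unique m zero    = ListAll.[] ListAllPairs.∷ ListAllPairs.[]
allVecs-unique m (suc s) = subst UniqueL (sym (allVecs-suc m s))
  (UniqueL.cartesianProductWith⁺ _∷_ ∷-injective (UniqueL.allFin⁺ m) (allVecs-unique m s))

Constant : ∀ {A : Set} {n} → Vec A (suc n) → Set
Constant v = All (_≡ head v) v

constant? : ∀ {m n} → Decidable (Constant {Fin m} {n})
constant? v = all? (_≟ head v) v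

constant-allVecs-↭ : ∀ m s → filter constant? (allVecs m (suc s)) ↭ mapL (replicate (suc s)) (allFin m)
constant-allVecs-↭ m s = ∼bag⇒↭ (unique∧set⇒bag
    (UniqueL.filter⁺ constant? (allVecs-unique m (suc s)))
    (UniqueL.map⁺ (proj₁ ∘ ∷-injective) (UniqueL.allFin⁺ m))
    (mk⇔ to from))
  where
  to : ∀ {v} → v ∈ filter constant? (allVecs m (suc s)) → v ∈ mapL (replicate (suc s)) (allFin m)
  to {v} v∈ = subst (_∈ _) (sym (All≡⇒replicate (proj₂ (∈-filter⁻ constant? {xs = allVecs m (suc s)} v∈))))
                    (∈-map⁺ (replicate (suc s)) (∈-allFin (head v)))
  from : ∀ {v} → v ∈ mapL (replicate (suc s)) (allFin m) → v ∈ filter constant? (allVecs m (suc s))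
  from v∈ with x , _ , refl ← ∈-map⁻ (replicate (suc s)) v∈ =
    ∈-filter⁺ constant? (∈-allVecs _) (All≡-replicate (suc s) x)

module _ {A L M : Set} {P : A → Set} (P? : Decidable P) {f g : A → L} {h₁ h₂ : A → M}
         (P-resp : ∀ {a b} → f a ≡ g b → P a ⇔ P b) (h-resp : ∀ {a b} → f a ≡ g b → h₁ a ≡ h₂ b) where

  map-filter-≡ : ∀ as bs → mapL f as ≡ mapL g bs → mapL h₁ (filter P? as) ≡ mapL h₂ (filter P? bs)
  map-filter-≡ []       []       _  = refl
  map-filter-≡ (a ∷ as) (b ∷ bs) eq with fa≡gb , rest ← ∷-injectiveL eq
    with P? a | P? b
  ... | yes _  | yes _  = cong₂ _∷_ (h-resp fa≡gb) (map-filter-≡ as bs rest)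
  ... | yes pa | no ¬pb = ⊥-elim (¬pb (Equivalence.to (P-resp fa≡gb) pa))
  ... | no ¬pa | yes pb = ⊥-elim (¬pa (Equivalence.from (P-resp fa≡gb) pb))
  ... | no _   | no _   = map-filter-≡ as bs rest

  map-filter-↭ : ∀ {as bs} → mapL f as ↭ mapL g bs → mapL h₁ (filter P? as) ↭ mapL h₂ (filter P? bs)
  map-filter-↭ {bs = bs} ρ with cs , g-bs≡f-cs , as↭cs ← ↭-map-inv f ρ =
    ↭-trans (map⁺ h₁ (filter-↭ P? as↭cs)) (↭-reflexive (map-filter-≡ cs bs (sym g-bs≡f-cs)))

module _ {L : Set} {m k} {γ : Vec (Fin m) k → L} (G : GraphLike k γ) {s} {I : Vec (Fin k) s} (I! : Distinct I)
         {W W′ : Vec (Fin m) k} {b c : Vec (Fin m) s} (γ≡ : γ (put W I b) ≡ γ (put W′ I c)) where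
  open GraphLike G

  put-preserves-equalities : ∀ i j → lookup b i ≡ lookup b j → lookup c i ≡ lookup c j
  put-preserves-equalities i j bᵢ≡bⱼ = begin
    lookup c i                    ≡⟨ sym (lookup-put-index W′ c I! i) ⟩
    lookup (put W′ I c) (lookup I i) ≡⟨ eq-inv _ _ γ≡ (lookup I i) (lookup I j) W-equal ⟩
    lookup (put W′ I c) (lookup I j) ≡⟨ lookup-put-index W′ c I! j ⟩
    lookup c j                    ∎
    where
    open ≡-Reasoning
    W-equal : lookup (put W I b) (lookup I i) ≡ lookup (put W I b) (lookup I j)
    W-equal = trans (lookup-put-index W b I! i) (trans bᵢ≡bⱼ (sym (lookup-put-index W b I! j)))

put-preserves-constant : ∀ {L : Set} {m k} {γ : Vec (Fin m) k → L} → GraphLike k γ → ∀ {n} {I : Vec (Fin k) (suc n)} →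
  Distinct I → ∀ {W W′} {b c : Vec (Fin m) (suc n)} → γ (put W I b) ≡ γ (put W′ I c) → Constant b → Constant c
put-preserves-constant G I! {b = x ∷ bs} {c = y ∷ cs} γ≡ b-const =
  lookup⁻ λ j → put-preserves-equalities G I! γ≡ j zero (lookup⁺ b-const j)

clamp-↑ˡ : ∀ {t} s (q : Fin (suc t)) → clamp (q ↑ˡ s) t ≡ q
clamp-↑ˡ         s zero    = refl
clamp-↑ˡ {suc t} s (suc q) = cong suc (clamp-↑ˡ s q)

↑ˡ≢↑ʳ : ∀ {a b} (i : Fin a) (j : Fin b) → ¬ (i ↑ˡ b) ≡ (a ↑ʳ j)
↑ˡ≢↑ʳ zero    j ()
↑ˡ≢↑ʳ (suc i) j eq = ↑ˡ≢↑ʳ i j (suc-injective eq)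

module _ {L : Set} {t s m} {γ : Vec (Fin m) (suc t + s) → L} (G : GraphLike (suc t + s) γ) where
  open GraphLike G

  extend : Vec (Fin m) (suc t) → Vec (Fin m) (suc t + s)
  extend w = tabulate λ q → lookup w (clamp q t)

  front : Vec (Fin (suc t + s)) (suc t)
  front = tabulate (_↑ˡ s)

  back : Vec (Fin (suc t + s)) s
  back = tabulate (suc t ↑ʳ_)

  I : Fin (suc t) → Vec (Fin (suc t + s)) (suc s)
  I p = (p ↑ˡ s) ∷ back

  front∉back : ∀ q → All (λ i → ¬ (q ↑ˡ s) ≡ i) back
  front∉back q = lookup⁻ λ j eq → ↑ˡ≢↑ʳ q j (trans eq (lookup∘tabulate (suc t ↑ʳ_) j))

  I-distinct : ∀ p → Distinct (I p)
  I-distinct p = front∉back p ∷ tabulate⁺ (↑ʳ-injective (suc t) _ _)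

  front-put : ∀ w p x xs → prj front (put (extend w) (I p) (x ∷ xs)) ≡ put w (p ∷ []) (x ∷ [])
  front-put w p x xs = lookup-ext λ q → begin
    lookup (prj front W) q      ≡⟨ lookup-map q (lookup W) front ⟩
    lookup W (lookup front q)   ≡⟨ cong (lookup W) (lookup∘tabulate (_↑ˡ s) q) ⟩
    lookup W (q ↑ˡ s)           ≡⟨ by-position q (p ≟ q) ⟩
    lookup (put w (p ∷ []) (x ∷ [])) q ∎
    where
    open ≡-Reasoning
    W = put (extend w) (I p) (x ∷ xs)
    by-position : ∀ q → Dec (p ≡ q) → lookup W (q ↑ˡ s) ≡ lookup (put w (p ∷ []) (x ∷ [])) q
    by-position q (yes refl) =
      trans (lookup-put-here (extend w) (p ↑ˡ s) back x xs) (sym (lookup-put-here w p [] x []))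
    by-position q (no p≢q)   = begin
      lookup W (q ↑ˡ s)
        ≡⟨ lookup-put-there (extend w) (p ↑ˡ s) back x xs (p≢q ∘ ↑ˡ-injective s p q) ⟩
      lookup (put (extend w) back xs) (q ↑ˡ s)
        ≡⟨ lookup-put-outside (extend w) xs (All.map (_∘ sym) (front∉back q)) ⟩
      lookup (extend w) (q ↑ˡ s)
        ≡⟨ trans (lookup∘tabulate (λ q′ → lookup w (clamp q′ t)) (q ↑ˡ s)) (cong (lookup w) (clamp-↑ˡ s q)) ⟩
      lookup w q
        ≡⟨ sym (lookup-put-there w p [] x [] p≢q) ⟩
      lookup (put w (p ∷ []) (x ∷ [])) q ∎

  colour probe : Fin (suc t) → Vec (Fin m) (suc t) → Vec (Fin m) (suc s) → L
  colour p w c = γ (put (extend w) (I p) c)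
  probe  p w c = pr t γ (prj front (put (extend w) (I p) c))

  multiset-as-constants : ∀ p w →
    multiset 1 (pr t γ) w (p ∷ []) ↭ mapL (probe p w) (filter constant? (allVecs m (suc s)))
  multiset-as-constants p w = begin
    mapL (λ x → pr t γ (put w (p ∷ []) x)) (allVecs m 1)
      ≡⟨ cong (mapL _) (allVecs-one m) ⟩
    mapL (λ x → pr t γ (put w (p ∷ []) x)) (mapL (_∷ []) (allFin m))
      ≡⟨ sym (map-∘ (allFin m)) ⟩
    mapL (λ x → pr t γ (put w (p ∷ []) (x ∷ []))) (allFin m)
      ≡⟨ map-cong (λ x → cong (pr t γ) (sym (front-put w p x (replicate s x)))) (allFin m) ⟩
    mapL (probe p w ∘ replicate (suc s)) (allFin m)
      ≡⟨ map-∘ (allFin m) ⟩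
    mapL (probe p w) (mapL (replicate (suc s)) (allFin m))
      ↭⟨ map⁺ (probe p w) (↭-sym (constant-allVecs-↭ m s)) ⟩
    mapL (probe p w) (filter constant? (allVecs m (suc s))) ∎
    where open PermutationReasoning

  CStable-pr : CStable (suc t + s) (suc s) γ → CStable (suc t) 1 (pr t γ)
  CStable-pr C u v = proj₁ , λ γ≡ → γ≡ , λ { (s≤s 1≤t) (p ∷ []) _ → begin
    multiset 1 (pr t γ) u (p ∷ []) ↭⟨ multiset-as-constants p u ⟩
    mapL (probe p u) (filter constant? (allVecs m (suc s)))
      ↭⟨ map-filter-↭ constant? (constant-resp p)
           (λ {b} {c} → probe-resp p {b} {c}) (multisets-↭ 1≤t γ≡ p) ⟩
    mapL (probe p v) (filter constant? (allVecs m (suc s))) ↭⟨ multiset-as-constants p v ⟨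
    multiset 1 (pr t γ) v (p ∷ []) ∎ }
    where
    open PermutationReasoning
    multisets-↭ : 1 ≤ t → pr t γ u ≡ pr t γ v → ∀ p →
      multiset (suc s) γ (extend u) (I p) ↭ multiset (suc s) γ (extend v) (I p)
    multisets-↭ 1≤t γ≡ p = proj₂ (proj₂ (C (extend u) (extend v)) γ≡) (s≤s (+-monoˡ-≤ s 1≤t)) (I p) (I-distinct p)
    constant-resp : ∀ p {b c} → colour p u b ≡ colour p v c → Constant b ⇔ Constant c
    constant-resp p γ≡ = mk⇔ (put-preserves-constant G (I-distinct p) γ≡) (put-preserves-constant G (I-distinct p) (sym γ≡))
    probe-resp : ∀ p {b c} → colour p u b ≡ colour p v c → probe p u b ≡ probe p v c
    probe-resp p {b} {c} = proj-inv t (m≤m+n (suc t) s) front (put (extend u) (I p) b) (put (extend v) (I p) c)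

CStable-pr-≡ : ∀ {L : Set} {t s m k} → suc t + s ≡ k → (γ : Vec (Fin m) k → L) →
               GraphLike k γ → CStable k (suc s) γ → CStable (suc t) 1 (pr t γ)
CStable-pr-≡ refl γ G = CStable-pr G

lemma7 : (k r : ℕ) → 1 ≤ r → r ≤ k → (m : ℕ) → {L : Set} → (γ : Vec (Fin m) k → L) →
         GraphLike k γ → CStable k r γ → CStable (suc (k ∸ r)) 1 (pr (k ∸ r) γ)
lemma7 k (suc s) _ r≤k m = CStable-pr-≡ (trans (sym (+-suc (k ∸ suc s) s)) (m∸n+n≡m r≤k))
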